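{- Consider 8-move peg solitaire on $Diamond(4)$. Then: (1) The central game (start with every hole occupied except the center $d4$, finish with a single peg at $d4$) cannot be solved in fewer than 10 moves. (2) No single vacancy to single survivor problem (start with every hole occupied except one hole, finish with exactly one peg anywhere) can be solved in fewer than 8 moves.
   Context: $Diamond(4)$ has columns a–g (identified with $x=1,\dots,7$) and rows 1–7 ($y=1,\dots,7$), and consists of the 25 holes $(x,y)$ with $|x-4|+|y-4|\le 3$; its center is $d4$. Each hole is empty or holds one peg. In 8-move solitaire a jump takes a peg at hole $p$, with hole $p+v$ occupied and $p+2v$ empty, where $v$ is one of the 8 horizontal, vertical or diagonal unit steps and all three holes lie on the board; the peg moves to $p+2v$ and the peg at $p+v$ is removed. A move is a maximal sequence of one or more consecutive jumps made by the same peg; the length of a solution is its number of moves. -}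

module Defs where

open import Data.Bool using (Bool; true; false; _∧_; not; if_then_else_)
open import Data.Nat using (ℕ; zero; suc; _+_; _≤ᵇ_)
open import Data.Integer as ℤ using (ℤ; +_; -[1+_]; ∣_∣)
open import Data.Product using (_×_; _,_; proj₁; proj₂)
open import Data.List using (List; []; _∷_)
open import Data.Maybe using (Maybe; just; nothing)
open import Relation.Nullary.Decidable using (⌊_⌋)
open import Relation.Binary.PropositionalEquality using (_≡_)

-- Holes are integer points (x , y); column a..g is x = 1..7, row 1..7 is y = 1..7.
Pos : Set
Pos = ℤ × ℤ

_+ᴾ_ : Pos → Pos → Pos
(a , b) +ᴾ (c , d) = (a ℤ.+ c , b ℤ.+ d)

_==ᴾ_ : Pos → Pos → Bool
(a , b) ==ᴾ (c , d) = ⌊ a ℤ.≟ c ⌋ ∧ ⌊ b ℤ.≟ d ⌋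

onBoard : Pos → Bool
onBoard (x , y) = (∣ x ℤ.- + 4 ∣ + ∣ y ℤ.- + 4 ∣) ≤ᵇ 3

d4 : Pos
d4 = (+ 4 , + 4)

data Dir : Set where
  E W N S NE NW SE SW : Dir

vec : Dir → Pos
vec E  = (+ 1 , + 0)
vec W  = (-[1+ 0 ] , + 0)
vec N  = (+ 0 , + 1)
vec S  = (+ 0 , -[1+ 0 ])
vec NE = (+ 1 , + 1)
vec NW = (-[1+ 0 ] , + 1)
vec SE = (+ 1 , -[1+ 0 ])
vec SW = (-[1+ 0 ] , -[1+ 0 ])

-- A board position: which holes hold a peg (values off the board are irrelevant).
State : Set
State = Pos → Bool

record Jump : Set where
  constructor jmp
  field
    from : Pos
    dir  : Dir

over : Jump → Pos
over (jmp p v) = p +ᴾ vec v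

landing : Jump → Pos
landing (jmp p v) = (p +ᴾ vec v) +ᴾ vec v

legal : State → Jump → Bool
legal s j = onBoard (Jump.from j) ∧ onBoard (over j) ∧ onBoard (landing j)
          ∧ s (Jump.from j) ∧ s (over j) ∧ not (s (landing j))

doJump : Jump → State → State
doJump j s q =
  if (q ==ᴾ Jump.from j) then false
  else if (q ==ᴾ over j) then false
  else if (q ==ᴾ landing j) then true
  else s q

run : State → List Jump → Maybe State
run s [] = just s
run s (j ∷ js) = if legal s j then run (doJump j s) js else nothing

-- Number of moves of a jump sequence: a move is a maximal run of consecutive
-- jumps by the same peg, i.e. each jump of the run starts where the previous
-- one landed.
movesAfter : Pos → List Jump → ℕ
movesAfter l [] = 0
movesAfter l (j ∷ js) =
  (if Jump.from j ==ᴾ l then 0 else 1) + movesAfter (landing j) js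

moves : List Jump → ℕ
moves [] = 0
moves (j ∷ js) = suc (movesAfter (landing j) js)

vacantAt : Pos → State
vacantAt h q = onBoard q ∧ not (q ==ᴾ h)

singlePegAt : Pos → State → Set
singlePegAt f s = ∀ q → onBoard q ≡ true → s q ≡ (q ==ᴾ f)

{-# OPTIONS --safe #-}
-- A corner of Diamond(4) can never be jumped over, and a side pair ({c2, b3} or
-- one of its three images) can be jumped over only by a jump that starts or lands in the pair. So
-- a full region that does not hold the peg moved last can only be emptied by a move starting
-- inside it: the number Φ of such regions never drops within a move and, the regions being
-- disjoint, drops by at most one per move. A single-vacancy start has Φ ≥ 7 and a finished game
-- Φ = 0; a search over the first jumps, pruned by this bound, raises 7 to 8.
-- In the central game the last peg, at d4, lies in the class of holes with both coordinates even,
-- which jumps preserve. One more unit, "the peg moved last is outside this class or a region hole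
-- is occupied", can only vanish when a move starts from an even hole, which lies in no region; so
-- the central game needs 9 moves, and a one-jump search gives 10.
module Submission where

open import Defs
open import Algebra.Properties.CommutativeSemigroup using (interchange)
open import Data.Bool using (Bool; true; false; _∧_; _∨_; not; if_then_else_; T)
open import Data.Bool.ListAction using (all)
import Data.Bool.Properties as Bool
open import Data.Fin using (Fin; zero; suc; toℕ; #_)
open import Data.Fin.Properties using (_≟_; any?; all?)
open import Data.Fin.Subset
  using (Subset; inside; outside; ⁅_⁆; ∁; _∪_; ⋃; _∈_; _∉_; _⊆_; _∩_; Nonempty; ∣_∣)
open import Data.Fin.Subset.Properties
  using (_∈?_; _⊆?_; nonempty?; x∈p∩q⁺; x∈p∩q⁻; x∈⁅y⁆⇒x≡y; ∣⁅x⁆∣≡1; ∣∁p∣≡n∸∣p∣)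
open import Data.Integer as ℤ using (ℤ; +_; -[1+_])
open import Data.List using (List; []; _∷_; concatMap; allFin; fromMaybe)
open import Data.List.Membership.Propositional using (lose) renaming (_∈_ to _∈ᴸ_)
open import Data.List.Membership.Propositional.Properties using (∈-concatMap⁺; ∈-allFin)
open import Data.List.Relation.Unary.All as All using (All; []; _∷_)
open import Data.List.Relation.Unary.All.Properties using (all⁺)
open import Data.List.Relation.Unary.Any using (Any; here; there)
open import Data.Maybe using (Maybe; just; nothing; _>>=_)
import Data.Maybe as Maybe
open import Data.Nat as ℕ
  using (ℕ; zero; suc; _+_; _*_; _∸_; _≤_; _<_; _<ᵇ_; _≤ᵇ_; _≤?_; z≤n; s≤s)
open import Data.Nat.Properties
  using (module ≤-Reasoning; +-commutativeSemigroup; ≤-refl; ≤-trans; ≤ᵇ⇒≤; <ᵇ⇒<; <-irrefl;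
         +-assoc; +-identityʳ; *-identityˡ; *-distribʳ-+; +-mono-≤; +-monoˡ-≤; +-monoʳ-≤; *-monoˡ-≤;
         m≤m+n; m≤n+m; m≤n+m∸n; m+n≤o⇒m≤o; m+n≤o⇒n≤o)
open import Data.Product using (_×_; _,_; Σ; ∃; ∃₂; proj₁; proj₂)
open import Data.Product.Properties using (≡-dec)
open import Data.Sum using (_⊎_; inj₁; inj₂; [_,_])
open import Data.Vec using (Vec; _∷_; []; lookup; tabulate; _[_]≔_)
open import Data.Vec.Properties
  using (lookup∘update; lookup∘update′; []=⇒lookup; lookup⇒[]=; lookup-map; lookup-replicate)
open import Data.Vec.Relation.Binary.Pointwise.Extensional using (ext; Pointwise-≡⇒≡)
open import Function using (_∘_)
open import Function.Bundles using (Equivalence)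
open import Relation.Binary.Definitions using (DecidableEquality)
open import Relation.Binary.PropositionalEquality
  using (_≡_; _≢_; refl; sym; trans; cong; cong₂; subst; subst₂; module ≡-Reasoning)
open import Relation.Nullary using (¬_; Dec; yes; no; does; contradiction)
open import Relation.Nullary.Decidable
  using (_×-dec_; _⊎-dec_; _→-dec_; ¬?; dec-true; dec-false; from-yes; dec⇒maybe; T?)

afterJump : (atFrom atOver atTo before : Bool) → Bool
afterJump atFrom atOver atTo before =
  if atFrom then false else if atOver then false else if atTo then true else before

afterJump-cong : ∀ {a a′ b b′ c c′ x x′} → a ≡ a′ → b ≡ b′ → c ≡ c′ → x ≡ x′ →
                 afterJump a b c x ≡ afterJump a′ b′ c′ x′
afterJump-cong refl refl refl refl = refl

lookup-⁅⁆ : ∀ {n} (y t : Fin n) → lookup ⁅ y ⁆ t ≡ does (t ≟ y)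
lookup-⁅⁆ zero    zero    = refl
lookup-⁅⁆ zero    (suc t) = lookup-replicate t outside
lookup-⁅⁆ (suc y) zero    = refl
lookup-⁅⁆ (suc y) (suc t) = lookup-⁅⁆ y t

single-not-many : ∀ {n} (y : Fin n) → ¬ (1 < ∣ ⁅ y ⁆ ∣)
single-not-many y many = <-irrefl refl (subst (1 <_) (∣⁅x⁆∣≡1 y) many)

lookup-≔ : ∀ {A : Set} {n} (xs : Vec A n) i y t →
           lookup (xs [ i ]≔ y) t ≡ (if does (t ≟ i) then y else lookup xs t)
lookup-≔ xs i y t with t ≟ i
... | yes refl = lookup∘update i xs y
... | no t≢i   = lookup∘update′ t≢i xs y

-- Stated with Any (y ≡_) rather than _∈ᴸ_: the latter elaborates the list at the element type
-- Setoid.Carrier (setoid B), and Agda then compares such a list with a concrete one like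
-- diamondLines by evaluating both in full.
∈-concatMap-allFin : ∀ {n} {B : Set} (f : Fin n → List B) i {y} → y ∈ᴸ f i →
                     Any (y ≡_) (concatMap f (allFin n))
∈-concatMap-allFin f i y∈ = ∈-concatMap⁺ f (lose (∈-allFin i) y∈)

𝟙 : Bool → ℕ
𝟙 true  = 1
𝟙 false = 0

𝟙≤1 : ∀ b → 𝟙 b ≤ 1
𝟙≤1 true  = s≤s z≤n
𝟙≤1 false = z≤n

𝟙≤1+ : ∀ b x → 𝟙 b ≤ 1 + x
𝟙≤1+ b x = ≤-trans (𝟙≤1 b) (m≤m+n 1 x)

𝟙-does-mono : ∀ {a b} {A : Set a} {B : Set b} (a? : Dec A) (b? : Dec B) → (A → B) →
              𝟙 (does a?) ≤ 𝟙 (does b?)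
𝟙-does-mono (yes a) (yes _) _   = ≤-refl
𝟙-does-mono (yes a) (no ¬b) a→b = contradiction (a→b a) ¬b
𝟙-does-mono (no _)  _       _   = z≤n

-- Peg solitaire on a board given by its lines

record Line (n : ℕ) : Set where
  constructor line
  field
    start middle end : Fin n

module Solitaire {n : ℕ} (lines : List (Line n)) where

  Board : Set
  Board = Subset n

  Legal : Board → Line n → Set
  Legal v (line i k m) = i ∈ v × k ∈ v × m ∉ v

  legal? : ∀ v ln → Dec (Legal v ln)
  legal? v (line i k m) = i ∈? v ×-dec k ∈? v ×-dec ¬? (m ∈? v)

  jump : Line n → Board → Board
  jump (line i k m) v = v [ m ]≔ inside [ k ]≔ outside [ i ]≔ outside

  lookup-jump : ∀ v i k m t →
    lookup (jump (line i k m) v) t ≡ afterJump (does (t ≟ i)) (does (t ≟ k)) (does (t ≟ m)) (lookup v t)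
  lookup-jump v i k m t
    rewrite lookup-≔ (v [ m ]≔ inside [ k ]≔ outside) i outside t
          | lookup-≔ (v [ m ]≔ inside) k outside t
          | lookup-≔ v m inside t = refl

  ∈-jump : ∀ {v i k m x} → x ∈ v → x ≢ i → x ≢ k → x ∈ jump (line i k m) v
  ∈-jump {v} {i} {k} {m} {x} x∈v x≢i x≢k =
    lookup⇒[]= x _ (trans (lookup-jump v i k m x) stays)
    where
    stays : afterJump (does (x ≟ i)) (does (x ≟ k)) (does (x ≟ m)) (lookup v x) ≡ inside
    stays with x ≟ i | x ≟ k | x ≟ m
    ... | yes x≡i | _        | _     = contradiction x≡i x≢i
    ... | no _    | yes x≡k  | _     = contradiction x≡k x≢k
    ... | no _    | no _     | yes _ = refl
    ... | no _    | no _     | no _  = []=⇒lookup x∈v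

  landing∈jump : ∀ {v i k m} → Legal v (line i k m) → m ∈ jump (line i k m) v
  landing∈jump {v} {i} {k} {m} (i∈v , k∈v , m∉v) =
    lookup⇒[]= m _ (trans (lookup-jump v i k m m) lands)
    where
    lands : afterJump (does (m ≟ i)) (does (m ≟ k)) (does (m ≟ m)) (lookup v m) ≡ inside
    lands with m ≟ i | m ≟ k | m ≟ m
    ... | yes refl | _        | _        = contradiction i∈v m∉v
    ... | no _     | yes refl | _        = contradiction k∈v m∉v
    ... | no _     | no _     | yes _    = refl
    ... | no _     | no _     | no m≢m   = contradiction refl m≢m

  -- l : Maybe (Fin n) is where the last jump landed (nothing before the first jump); a jump
  -- starting there continues the current move and costs nothing.
  cost : Maybe (Fin n) → Fin n → ℕ
  cost (just j) i = if does (i ≟ j) then 0 else 1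
  cost nothing  _ = 1

  cost-cases : ∀ l i → cost l i ≡ 1 ⊎ l ≡ just i
  cost-cases nothing  i = inj₁ refl
  cost-cases (just j) i with i ≟ j
  ... | yes refl = inj₂ refl
  ... | no _     = inj₁ refl

  data Solution (y : Fin n) : Maybe (Fin n) → Board → ℕ → Set where
    done : Solution y (just y) ⁅ y ⁆ 0
    step : ∀ {l v c i k m} → line i k m ∈ᴸ lines → Legal v (line i k m) →
           Solution y (just m) (jump (line i k m) v) c → Solution y l v (cost l i + c)

  Potential : Set
  Potential = Board → Maybe (Fin n) → ℕ

  ChargedBy : (Fin n → ℕ) → Potential → Set
  ChargedBy w Φ = ∀ v l {i k m} → line i k m ∈ᴸ lines → Legal v (line i k m) →
                  Φ v l ≤ w i * cost l i + Φ (jump (line i k m) v) (just m)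

  Charged : Potential → Set
  Charged = ChargedBy (λ _ → 1)

  charged-+ : ∀ {w₁ w₂ Φ₁ Φ₂} → ChargedBy w₁ Φ₁ → ChargedBy w₂ Φ₂ →
              ChargedBy (λ i → w₁ i + w₂ i) (λ v l → Φ₁ v l + Φ₂ v l)
  charged-+ {w₁} {w₂} {Φ₁} {Φ₂} ch₁ ch₂ v l {i} {k} {m} ln lg = begin
      Φ₁ v l + Φ₂ v l
    ≤⟨ +-mono-≤ (ch₁ v l ln lg) (ch₂ v l ln lg) ⟩
      (w₁ i * c + Φ₁ v′ (just m)) + (w₂ i * c + Φ₂ v′ (just m))
    ≡⟨ interchange +-commutativeSemigroup (w₁ i * c) (Φ₁ v′ (just m)) (w₂ i * c) (Φ₂ v′ (just m)) ⟩
      (w₁ i * c + w₂ i * c) + (Φ₁ v′ (just m) + Φ₂ v′ (just m))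
    ≡⟨ cong (_+ (Φ₁ v′ (just m) + Φ₂ v′ (just m))) (sym (*-distribʳ-+ c (w₁ i) (w₂ i))) ⟩
      (w₁ i + w₂ i) * c + (Φ₁ v′ (just m) + Φ₂ v′ (just m))
    ∎
    where
    open ≤-Reasoning
    c  = cost l i
    v′ = jump (line i k m) v

  charged-mono : ∀ {w w′ Φ} → (∀ i → w i ≤ w′ i) → ChargedBy w Φ → ChargedBy w′ Φ
  charged-mono w≤w′ ch v l {i} ln lg =
    ≤-trans (ch v l ln lg) (+-monoˡ-≤ _ (*-monoˡ-≤ (cost l i) (w≤w′ i)))

  solution-bound : ∀ {Φ y l v c} → Charged Φ → Solution y l v c → Φ v l ≤ c + Φ ⁅ y ⁆ (just y)
  solution-bound ch done = ≤-refl
  solution-bound {Φ} {y} ch (step {l} {v} {c} {i} {k} {m} ln lg sol) = begin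
      Φ v l
    ≤⟨ ch v l ln lg ⟩
      1 * cost l i + Φ (jump (line i k m) v) (just m)
    ≤⟨ +-monoʳ-≤ (1 * cost l i) (solution-bound {Φ} ch sol) ⟩
      1 * cost l i + (c + Φ ⁅ y ⁆ (just y))
    ≡⟨ cong (_+ (c + Φ ⁅ y ⁆ (just y))) (*-identityˡ (cost l i)) ⟩
      cost l i + (c + Φ ⁅ y ⁆ (just y))
    ≡⟨ sym (+-assoc (cost l i) c _) ⟩
      cost l i + c + Φ ⁅ y ⁆ (just y)
    ∎
    where open ≤-Reasoning

  lastIn : Maybe (Fin n) → Subset n → Bool
  lastIn nothing  _ = false
  lastIn (just i) R = does (i ∈? R)

  Sealed : Subset n → Set
  Sealed R = All (λ { (line i k m) → k ∈ R → i ∈ R ⊎ m ∈ R }) lines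

  sealed? : ∀ R → Dec (Sealed R)
  sealed? R = All.all? (λ { (line i k m) → k ∈? R →-dec (i ∈? R ⊎-dec m ∈? R) }) lines

  full : Subset n → Potential
  full R v l = 𝟙 (not (lastIn l R) ∧ does (R ⊆? v))

  full-stays-full : ∀ {R v i k m} → Sealed R → line i k m ∈ᴸ lines → Legal v (line i k m) →
                    i ∉ R → R ⊆ v → R ⊆ jump (line i k m) v
  full-stays-full sealed ln (_ , _ , m∉v) i∉R R⊆v x∈R =
    ∈-jump (R⊆v x∈R) (λ { refl → i∉R x∈R })
                     (λ { refl → [ i∉R , m∉v ∘ R⊆v ] (All.lookup sealed ln x∈R) })

  full-charged : ∀ {R} → Sealed R → ChargedBy (λ i → 𝟙 (does (i ∈? R))) (full R)
  full-charged {R} sealed v l {i} {k} {m} ln lg@(_ , _ , m∉v) with i ∈? R | cost-cases l i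
  ... | yes i∈R | inj₁ c≡1 rewrite c≡1 = 𝟙≤1+ _ _
  ... | yes i∈R | inj₂ refl rewrite dec-true (i ∈? R) i∈R = z≤n
  ... | no i∉R  | _ with lastIn l R | R ⊆? v
  ...   | true  | _       = z≤n
  ...   | false | no _    = z≤n
  ...   | false | yes R⊆v
          rewrite dec-false (m ∈? R) (m∉v ∘ R⊆v)
                | dec-true (R ⊆? jump (line i k m) v) (full-stays-full sealed ln lg i∉R R⊆v) = ≤-refl

  fullRegions : List (Subset n) → Potential
  fullRegions []       v l = 0
  fullRegions (R ∷ Rs) v l = full R v l + fullRegions Rs v l

  multiplicity : List (Subset n) → Fin n → ℕ
  multiplicity []       i = 0
  multiplicity (R ∷ Rs) i = 𝟙 (does (i ∈? R)) + multiplicity Rs i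

  fullRegions-charged : ∀ {Rs} → All Sealed Rs → ChargedBy (multiplicity Rs) (fullRegions Rs)
  fullRegions-charged []               _ _ _ _ = z≤n
  fullRegions-charged {R ∷ Rs} (sealed ∷ sealeds) =
    charged-+ {λ i → 𝟙 (does (i ∈? R))} {multiplicity Rs} {full R} {fullRegions Rs}
              (full-charged sealed) (fullRegions-charged sealeds)

  Confined : Subset n → Subset n → Set
  Confined C B =
    All (λ { (line i k m) → (i ∈ C → m ∈ C × i ∉ B × k ∉ B) × (m ∈ C → i ∈ C) }) lines

  confined? : ∀ C B → Dec (Confined C B)
  confined? C B = All.all? (λ { (line i k m) →
    (i ∈? C →-dec (m ∈? C ×-dec ¬? (i ∈? B) ×-dec ¬? (k ∈? B))) ×-dec (m ∈? C →-dec i ∈? C) }) lines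

  strayOrOccupied : Subset n → Subset n → Potential
  strayOrOccupied C B v l = 𝟙 (not (lastIn l C) ∨ does (nonempty? (B ∩ v)))

  nonempty-stays-nonempty : ∀ {B v i k m} → i ∉ B → k ∉ B →
                            Nonempty (B ∩ v) → Nonempty (B ∩ jump (line i k m) v)
  nonempty-stays-nonempty {B} {v} i∉B k∉B (x , x∈B∩v) =
    let x∈B , x∈v = x∈p∩q⁻ B v x∈B∩v
    in x , x∈p∩q⁺ (x∈B , ∈-jump x∈v (λ { refl → i∉B x∈B }) (λ { refl → k∉B x∈B }))

  strayOrOccupied-charged : ∀ {C B} → Confined C B →
                            ChargedBy (λ i → 𝟙 (does (i ∈? C))) (strayOrOccupied C B)
  strayOrOccupied-charged {C} {B} confined v l {i} {k} {m} ln lg with i ∈? C | All.lookup confined ln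
  ... | no i∉C  | _ , m∈C→i∈C rewrite dec-false (m ∈? C) (i∉C ∘ m∈C→i∈C) = 𝟙≤1 _
  ... | yes i∈C | i∈C→ , _ with cost-cases l i | i∈C→ i∈C
  ...   | inj₁ c≡1 | _ rewrite c≡1 = 𝟙≤1+ _ _
  ...   | inj₂ refl | m∈C , i∉B , k∉B
          rewrite dec-true (i ∈? C) i∈C | dec-true (m ∈? C) m∈C =
            ≤-trans (𝟙-does-mono (nonempty? (B ∩ v)) (nonempty? (B ∩ jump (line i k m) v))
                                 (nonempty-stays-nonempty i∉B k∉B))
                    (m≤n+m _ _)

  -- Branch and bound; the guard 1 <ᵇ ∣ v ∣ keeps a one-peg position, where the game may end,
  -- from being expanded.
  mutual
    certify : Potential → (fuel target : ℕ) → Board → Maybe (Fin n) → Bool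
    certify Φ zero    t v l = t ≤ᵇ Φ v l
    certify Φ (suc f) t v l = (t ≤ᵇ Φ v l) ∨ ((1 <ᵇ ∣ v ∣) ∧ all (certifyAfter Φ f t v l) lines)

    certifyAfter : Potential → (fuel target : ℕ) → Board → Maybe (Fin n) → Line n → Bool
    certifyAfter Φ f t v l ln@(line i k m) =
      not (does (legal? v ln)) ∨ certify Φ f (t ∸ cost l i) (jump ln v) (just m)

  certify-sound : ∀ Φ y → Charged Φ → Φ ⁅ y ⁆ (just y) ≡ 0 →
                  ∀ fuel t v l {c} → T (certify Φ fuel t v l) → Solution y l v c → t ≤ c
  certify-sound Φ y charged final fuel t v l = sound fuel {t} {v} {l}
    where
    bounded : ∀ {t v l c} → T (t ≤ᵇ Φ v l) → Solution y l v c → t ≤ c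
    bounded {t} {v} {l} {c} h sol = begin
      t                      ≤⟨ ≤ᵇ⇒≤ t (Φ v l) h ⟩
      Φ v l                  ≤⟨ solution-bound {Φ} charged sol ⟩
      c + Φ ⁅ y ⁆ (just y)   ≡⟨ cong (λ x → c + x) final ⟩
      c + 0                  ≡⟨ +-identityʳ c ⟩
      c                      ∎
      where open ≤-Reasoning

    legal-cost-agrees : ∀ {v ln b} → T (not (does (legal? v ln)) ∨ b) → Legal v ln → T b
    legal-cost-agrees {v} {ln} h lg rewrite dec-true (legal? v ln) lg = h

    sound : ∀ f {t v l c} → T (certify Φ f t v l) → Solution y l v c → t ≤ c
    sound zero    h sol = bounded h sol
    sound (suc f) {t} {v} {l} h sol with Equivalence.to (Bool.T-∨ {t ≤ᵇ Φ v l}) h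
    ... | inj₁ h′ = bounded h′ sol
    ... | inj₂ h′ with Equivalence.to (Bool.T-∧ {1 <ᵇ ∣ v ∣}) h′ | sol
    ...   | many , _   | done = contradiction (<ᵇ⇒< 1 ∣ ⁅ y ⁆ ∣ many) (single-not-many y)
    ...   | _ , after | step {i = i} ln lg sol′ =
      let next = legal-cost-agrees (All.lookup (all⁺ (certifyAfter Φ f t v l) lines after) ln) lg
      in ≤-trans (m≤n+m∸n t (cost l i)) (+-monoʳ-≤ (cost l i) (sound f next sol′))

-- The board Diamond(4)

holes : Vec Pos 25
holes = (+ 4 , + 1)
      ∷ (+ 3 , + 2) ∷ (+ 4 , + 2) ∷ (+ 5 , + 2)
      ∷ (+ 2 , + 3) ∷ (+ 3 , + 3) ∷ (+ 4 , + 3) ∷ (+ 5 , + 3) ∷ (+ 6 , + 3)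
      ∷ (+ 1 , + 4) ∷ (+ 2 , + 4) ∷ (+ 3 , + 4) ∷ (+ 4 , + 4) ∷ (+ 5 , + 4) ∷ (+ 6 , + 4) ∷ (+ 7 , + 4)
      ∷ (+ 2 , + 5) ∷ (+ 3 , + 5) ∷ (+ 4 , + 5) ∷ (+ 5 , + 5) ∷ (+ 6 , + 5)
      ∷ (+ 3 , + 6) ∷ (+ 4 , + 6) ∷ (+ 5 , + 6)
      ∷ (+ 4 , + 7)
      ∷ []

hole : Fin 25 → Pos
hole = lookup holes

_≟ᴾ_ : DecidableEquality Pos
_≟ᴾ_ = ≡-dec ℤ._≟_ ℤ._≟_

hole? : ∀ p → Dec (∃ λ i → hole i ≡ p)
hole? p = any? (λ i → hole i ≟ᴾ p)

hole-onBoard : ∀ i → onBoard (hole i) ≡ true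
hole-onBoard = from-yes (all? λ i → onBoard (hole i) Bool.≟ true)

==ᴾ-hole : ∀ i j → (hole i ==ᴾ hole j) ≡ does (i ≟ j)
==ᴾ-hole = from-yes (all? λ i → all? λ j → (hole i ==ᴾ hole j) Bool.≟ does (i ≟ j))

coord : Fin 7 → ℤ
coord c = + suc (toℕ c)

coordinate : ∀ x → ℤ.∣ x ℤ.- + 4 ∣ ≤ 3 → ∃ λ c → x ≡ coord c
coordinate (+ 1) _ = # 0 , refl
coordinate (+ 2) _ = # 1 , refl
coordinate (+ 3) _ = # 2 , refl
coordinate (+ 4) _ = # 3 , refl
coordinate (+ 5) _ = # 4 , refl
coordinate (+ 6) _ = # 5 , refl
coordinate (+ 7) _ = # 6 , refl
coordinate (+ 0) (s≤s (s≤s (s≤s ())))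
coordinate (+ suc (suc (suc (suc (suc (suc (suc (suc _)))))))) (s≤s (s≤s (s≤s ())))
coordinate -[1+ n ] (s≤s (s≤s n+3≤1)) = contradiction (m+n≤o⇒n≤o n n+3≤1) λ { (s≤s ()) }

hole-surjective : ∀ p → onBoard p ≡ true → ∃ λ i → hole i ≡ p
hole-surjective (x , y) on
  with coordinate x (m+n≤o⇒m≤o _ bound) | coordinate y (m+n≤o⇒n≤o _ bound)
  where bound = ≤ᵇ⇒≤ _ 3 (Equivalence.from Bool.T-≡ on)
... | a , refl | b , refl = grid a b on
  where
  grid : ∀ a b → onBoard (coord a , coord b) ≡ true → ∃ λ i → hole i ≡ (coord a , coord b)
  grid = from-yes (all? λ a → all? λ b →
                     (onBoard (coord a , coord b) Bool.≟ true) →-dec hole? (coord a , coord b))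

holeAt : Pos → Maybe (Fin 25)
holeAt p = Maybe.map proj₁ (dec⇒maybe (hole? p))

holeAt-complete : ∀ p → onBoard p ≡ true → ∃ λ i → holeAt p ≡ just i × hole i ≡ p
holeAt-complete p on with hole? p
... | yes (i , hole-i≡p) = i , refl , hole-i≡p
... | no ∄i             = contradiction (hole-surjective p on) ∄i

directions : List Dir
directions = E ∷ W ∷ N ∷ S ∷ NE ∷ NW ∷ SE ∷ SW ∷ []

∈-directions : ∀ d → d ∈ᴸ directions
∈-directions E  = here refl
∈-directions W  = there (here refl)
∈-directions N  = there (there (here refl))
∈-directions S  = there (there (there (here refl)))
∈-directions NE = there (there (there (there (here refl))))
∈-directions NW = there (there (there (there (there (here refl)))))
∈-directions SE = there (there (there (there (there (there (here refl))))))
∈-directions SW = there (there (there (there (there (there (there (here refl)))))))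

lineFrom : Fin 25 → Dir → Maybe (Line 25)
lineFrom i d = do
  k ← holeAt (over (jmp (hole i) d))
  m ← holeAt (landing (jmp (hole i) d))
  just (line i k m)

linesFrom : Fin 25 → List (Line 25)
linesFrom i = concatMap (fromMaybe ∘ lineFrom i) directions

diamondLines : List (Line 25)
diamondLines = concatMap linesFrom (allFin 25)

lineFrom-just : ∀ i d {k m} → holeAt (over (jmp (hole i) d)) ≡ just k →
                holeAt (landing (jmp (hole i) d)) ≡ just m → lineFrom i d ≡ just (line i k m)
lineFrom-just i d {k} at-k at-m = trans
  (cong (_>>= λ k′ → holeAt (landing (jmp (hole i) d)) >>= λ m′ → just (line i k′ m′)) at-k)
  (cong (_>>= λ m′ → just (line i k m′)) at-m)

∈-diamondLines : ∀ i d {ln} → ln ∈ᴸ fromMaybe (lineFrom i d) → ln ∈ᴸ diamondLines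
∈-diamondLines i d ln∈ =
  ∈-concatMap-allFin linesFrom i (∈-concatMap⁺ (fromMaybe ∘ lineFrom i) (lose (∈-directions d) ln∈))

line-of-jump : ∀ i d → onBoard (over (jmp (hole i) d)) ≡ true →
               onBoard (landing (jmp (hole i) d)) ≡ true →
               ∃₂ λ k m → line i k m ∈ᴸ diamondLines
                        × hole k ≡ over (jmp (hole i) d) × hole m ≡ landing (jmp (hole i) d)
line-of-jump i d on-k on-m =
  let k , at-k , hole-k = holeAt-complete (over (jmp (hole i) d)) on-k
      m , at-m , hole-m = holeAt-complete (landing (jmp (hole i) d)) on-m
      ∈lineFrom = subst (λ r → line i k m ∈ᴸ fromMaybe r) (sym (lineFrom-just i d at-k at-m))
                        (here refl)
  in k , m , ∈-diamondLines i d ∈lineFrom , hole-k , hole-m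

open Solitaire diamondLines

record _≈_ (s : State) (v : Board) : Set where
  constructor agree
  field
    agrees : ∀ i → s (hole i) ≡ lookup v i
open _≈_

vacantAt-≈ : ∀ x → vacantAt (hole x) ≈ ∁ ⁅ x ⁆
vacantAt-≈ x = agree λ t → begin
    onBoard (hole t) ∧ not (hole t ==ᴾ hole x)
  ≡⟨ cong₂ (λ a b → a ∧ not b) (hole-onBoard t) (==ᴾ-hole t x) ⟩
    not (does (t ≟ x))
  ≡⟨ cong not (sym (lookup-⁅⁆ x t)) ⟩
    not (lookup ⁅ x ⁆ t)
  ≡⟨ sym (lookup-map t not ⁅ x ⁆) ⟩
    lookup (∁ ⁅ x ⁆) t
  ∎
  where open ≡-Reasoning

singlePeg-≈ : ∀ {s v y} → s ≈ v → singlePegAt (hole y) s → v ≡ ⁅ y ⁆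
singlePeg-≈ {s} {v} {y} s≈v single = Pointwise-≡⇒≡ (ext λ t → begin
    lookup v t           ≡⟨ sym (agrees s≈v t) ⟩
    s (hole t)           ≡⟨ single (hole t) (hole-onBoard t) ⟩
    hole t ==ᴾ hole y    ≡⟨ ==ᴾ-hole t y ⟩
    does (t ≟ y)         ≡⟨ sym (lookup-⁅⁆ y t) ⟩
    lookup ⁅ y ⁆ t       ∎)
  where open ≡-Reasoning

legal-parts : ∀ {s} j → legal s j ≡ true →
  onBoard (Jump.from j) ≡ true × onBoard (over j) ≡ true × onBoard (landing j) ≡ true ×
  s (Jump.from j) ≡ true × s (over j) ≡ true × s (landing j) ≡ false
legal-parts {s} j lg with onBoard (Jump.from j) | onBoard (over j) | onBoard (landing j)
                        | s (Jump.from j) | s (over j) | s (landing j)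
legal-parts j refl | true  | true  | true  | true  | true  | false = refl , refl , refl , refl , refl , refl
legal-parts j ()   | false | _     | _     | _     | _     | _
legal-parts j ()   | true  | false | _     | _     | _     | _
legal-parts j ()   | true  | true  | false | _     | _     | _
legal-parts j ()   | true  | true  | true  | false | _     | _
legal-parts j ()   | true  | true  | true  | true  | false | _
legal-parts j ()   | true  | true  | true  | true  | true  | true

record BoardJump (s : State) (v : Board) (j : Jump) : Set where
  field
    i k m     : Fin 25
    onLine    : line i k m ∈ᴸ diamondLines
    isLegal   : Legal v (line i k m)
    from≡     : Jump.from j ≡ hole i
    landing≡  : landing j ≡ hole m
    simulates : doJump j s ≈ jump (line i k m) v

==ᴾ-hole-at : ∀ t {x q} → hole x ≡ q → (hole t ==ᴾ q) ≡ does (t ≟ x)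
==ᴾ-hole-at t {x} refl = ==ᴾ-hole t x

boardJumpAt : ∀ {s v} i d → s ≈ v → legal s (jmp (hole i) d) ≡ true →
              BoardJump s v (jmp (hole i) d)
boardJumpAt {s} {v} i d s≈v lg =
  let _ , on-k , on-m , s-i , s-k , s-m = legal-parts {s} (jmp (hole i) d) lg
      k , m , onLine , hole-k , hole-m  = line-of-jump i d on-k on-m
      m∉v : m ∉ v
      m∉v m∈v = contradiction (trans (sym (trans (cong s hole-m) s-m)) (trans (agrees s≈v m) ([]=⇒lookup m∈v)))
                              λ ()
  in record
    { i = i ; k = k ; m = m ; onLine = onLine
    ; isLegal   = lookup⇒[]= i v (trans (sym (agrees s≈v i)) s-i)
                , lookup⇒[]= k v (trans (sym (agrees s≈v k)) (trans (cong s hole-k) s-k))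
                , m∉v
    ; from≡     = refl
    ; landing≡  = sym hole-m
    ; simulates = agree λ t →
        trans (afterJump-cong (==ᴾ-hole t i) (==ᴾ-hole-at t hole-k) (==ᴾ-hole-at t hole-m) (agrees s≈v t))
              (sym (lookup-jump v i k m t))
    }

boardJump : ∀ {s v} j → s ≈ v → legal s j ≡ true → BoardJump s v j
boardJump {s} (jmp p d) s≈v lg with hole-surjective p (proj₁ (legal-parts {s} (jmp p d) lg))
... | i , refl = boardJumpAt i d s≈v lg

cost-agrees : ∀ {j i} m → Jump.from j ≡ hole i →
            cost (just m) i ≡ (if Jump.from j ==ᴾ hole m then 0 else 1)
cost-agrees {i = i} m refl = cong (λ b → if b then 0 else 1) (sym (==ᴾ-hole i m))

mutual
  simulate-after : ∀ {s v y} m js {s′} → s ≈ v → m ∈ v → run s js ≡ just s′ →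
                   singlePegAt (hole y) s′ → Solution y (just m) v (movesAfter (hole m) js)
  simulate-after {y = y} m [] s≈v m∈v refl single =
    let v≡⁅y⁆ = singlePeg-≈ {y = y} s≈v single
        m≡y   = x∈⁅y⁆⇒x≡y y (subst (m ∈_) v≡⁅y⁆ m∈v)
    in subst₂ (λ l w → Solution y l w 0) (cong just (sym m≡y)) (sym v≡⁅y⁆) done
  simulate-after {s} {v} {y} m (j ∷ js) s≈v m∈v run≡ single with legal s j in lg
  ... | true  = let i , from≡ , sol = simulate-jump {y = y} (just m) j js s≈v lg run≡ single
                in subst (λ c → Solution y (just m) v (c + movesAfter (landing j) js))
                         (cost-agrees {j} {i} m from≡) sol
  ... | false = contradiction run≡ λ ()

  simulate-jump : ∀ {s v y} l j js {s′} → s ≈ v → legal s j ≡ true → run (doJump j s) js ≡ just s′ →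
                  singlePegAt (hole y) s′ →
                  ∃ λ i → Jump.from j ≡ hole i × Solution y l v (cost l i + movesAfter (landing j) js)
  simulate-jump {s} {v} {y} l j js s≈v lg run≡ single =
    let open BoardJump (boardJump j s≈v lg)
        rest = simulate-after {y = y} m js simulates (landing∈jump isLegal) run≡ single
    in i , from≡ , step onLine isLegal
                     (subst (λ p → Solution y (just m) (jump (line i k m) v) (movesAfter p js)) (sym landing≡) rest)

simulate : ∀ {s v y} js {s′} → s ≈ v → 1 < ∣ v ∣ → run s js ≡ just s′ → singlePegAt (hole y) s′ →
           Solution y nothing v (moves js)
simulate {y = y} [] s≈v many refl single =
  contradiction (subst (λ w → 1 < ∣ w ∣) (singlePeg-≈ {y = y} s≈v single) many) (single-not-many y)
simulate {s} {y = y} (j ∷ js) s≈v _ run≡ single with legal s j in lg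
... | true  = proj₂ (proj₂ (simulate-jump {y = y} nothing j js s≈v lg run≡ single))
... | false = contradiction run≡ λ ()

-- Merson regions of Diamond(4) and the two bounds

at : ℕ → ℕ → Subset 25
at x y = tabulate (λ i → hole i ==ᴾ (+ x , + y))

cornersAndSides : List (Subset 25)
cornersAndSides =
  at 4 1 ∷ at 1 4 ∷ at 7 4 ∷ at 4 7 ∷
  (at 3 2 ∪ at 2 3) ∷ (at 2 5 ∪ at 3 6) ∷ (at 5 6 ∪ at 6 5) ∷ (at 6 3 ∪ at 5 2) ∷ []

evenHoles : Subset 25
evenHoles = at 4 2 ∪ at 2 4 ∪ at 4 4 ∪ at 6 4 ∪ at 4 6

Φ : Potential
Φ = fullRegions cornersAndSides

Φᶜ : Potential
Φᶜ v l = strayOrOccupied evenHoles (⋃ cornersAndSides) v l + Φ v l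

center : Fin 25
center = proj₁ (hole-surjective d4 refl)

many-pegs : ∀ x → 1 < ∣ ∁ ⁅ x ⁆ ∣
many-pegs x =
  subst (1 <_) (sym (trans (∣∁p∣≡n∸∣p∣ ⁅ x ⁆) (cong (25 ∸_) (∣⁅x⁆∣≡1 x)))) (s≤s (s≤s z≤n))

cornersAndSides-sealed : All Sealed cornersAndSides
cornersAndSides-sealed = from-yes (All.all? sealed? cornersAndSides)

evenHoles-confined : Confined evenHoles (⋃ cornersAndSides)
evenHoles-confined = from-yes (confined? evenHoles (⋃ cornersAndSides))

Φ-charged : Charged Φ
Φ-charged = charged-mono (from-yes (all? λ i → multiplicity cornersAndSides i ≤? 1))
                         (fullRegions-charged cornersAndSides-sealed)

Φᶜ-charged : Charged Φᶜ
Φᶜ-charged =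
  charged-mono {λ i → 𝟙 (does (i ∈? evenHoles)) + multiplicity cornersAndSides i}
               (from-yes (all? λ i → 𝟙 (does (i ∈? evenHoles)) + multiplicity cornersAndSides i ≤? 1))
               (charged-+ {λ i → 𝟙 (does (i ∈? evenHoles))} {multiplicity cornersAndSides}
                          {strayOrOccupied evenHoles (⋃ cornersAndSides)} {Φ}
                          (strayOrOccupied-charged evenHoles-confined) (fullRegions-charged cornersAndSides-sealed))

Φ-final : ∀ y → Φ ⁅ y ⁆ (just y) ≡ 0
Φ-final = from-yes (all? λ y → Φ ⁅ y ⁆ (just y) ℕ.≟ 0)

central-certified : T (certify Φᶜ 1 10 (∁ ⁅ center ⁆) nothing)
central-certified = Equivalence.from Bool.T-≡ refl

-- Only a vacancy inside a region (Φ = 7 at the start) needs the search: to depth 2 at a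
-- corner, 13 in a side pair.
vacancy-certified : ∀ x → T (certify Φ 13 8 (∁ ⁅ x ⁆) nothing)
vacancy-certified = from-yes (all? λ x → T? (certify Φ 13 8 (∁ ⁅ x ⁆) nothing))

central-game-bound : (js : List Jump) (s : State) → run (vacantAt d4) js ≡ just s →
                     singlePegAt d4 s → 10 ≤ moves js
central-game-bound js s run≡ single =
  certify-sound Φᶜ center Φᶜ-charged refl 1 10 (∁ ⁅ center ⁆) nothing central-certified
    (simulate js (vacantAt-≈ center) (many-pegs center) run≡ single)

single-vacancy-bound : (h : Pos) → onBoard h ≡ true → (js : List Jump) (s : State) →
                       run (vacantAt h) js ≡ just s →
                       Σ Pos (λ f → onBoard f ≡ true × singlePegAt f s) → 8 ≤ moves js
single-vacancy-bound h on-h js s run≡ (f , on-f , single)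
  with hole-surjective h on-h | hole-surjective f on-f
... | x , refl | y , refl =
  certify-sound Φ y Φ-charged (Φ-final y) 13 8 (∁ ⁅ x ⁆) nothing (vacancy-certified x)
    (simulate js (vacantAt-≈ x) (many-pegs x) run≡ single)

theorem3 :
    ((js : List Jump) (s : State) →
      run (vacantAt d4) js ≡ just s → singlePegAt d4 s → 10 ≤ moves js)
    × ((h : Pos) → onBoard h ≡ true → (js : List Jump) (s : State) →
      run (vacantAt h) js ≡ just s →
      Σ Pos (λ f → onBoard f ≡ true × singlePegAt f s) → 8 ≤ moves js)
theorem3 = central-game-bound , single-vacancy-bound
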